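{- Every element of $\Gamma_e$ is an extreme point of the set $\Lambda$ of profile vectors of non-trivial intersecting families $\mathcal{F}\subseteq 2^{[n]}$.
   Context: $[n]=\{1,\dots,n\}$. A family is intersecting if any two members intersect; it is trivial if some element lies in all its members, non-trivial otherwise. The profile vector of $\mathcal{F}$ is $(f_0,\dots,f_n)$, $f_i$ the number of $i$-element members. A point of a set of vectors is extreme if it is not a convex combination of other points of that set. $P$ is the set of vectors $(e_0,\dots,e_n)$ such that every $e_i$ is a non-negative integer, $e_0=e_1=e_n=0$, $x:=\sum_{i=2}^{n-1}e_i\ge 3$, and $\sum_{i=2}^{n-1} i e_i\le (x-1)n$; $\Gamma_e$ is the set of extreme points of $P$.
   Formalization: The coefficients of the convex combinations that define extreme points, of P and of Λ alike, are taken in the rationals. -}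

module Defs where

open import Data.Nat as ℕ using (ℕ; zero; suc; _∸_; _≟_; _<?_)
open import Data.Fin using (Fin; fromℕ<)
open import Data.Fin.Subset using (Subset; _∈_; _∩_; ∣_∣; Nonempty)
open import Data.Vec using (Vec; lookup; tabulate)
open import Data.List using (List; []; _∷_; map; filter; length; upTo; foldr)
open import Data.Nat.ListAction using (sum)
open import Data.List.Membership.Propositional renaming (_∈_ to _∈ₗ_)
open import Data.List.Relation.Unary.Unique.Propositional using (Unique)
open import Data.List.Relation.Unary.All using (All)
open import Data.Product using (Σ; _×_; ∃; _,_)
open import Data.Integer using (+_)
open import Data.Rational as ℚ using (ℚ; 0ℚ; 1ℚ; _/_)
open import Relation.Binary.PropositionalEquality using (_≡_; _≢_)
open import Relation.Nullary using (¬_; yes; no)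

-- Vectors (e_0, …, e_n) are elements of Vec ℕ (suc n); coordinate i is read via `at`,
-- which returns 0 for out-of-range indices (only used for indices in range here).
at : ∀ {n} → Vec ℕ (suc n) → ℕ → ℕ
at {n} e i with i <? suc n
... | yes p = lookup e (fromℕ< p)
... | no _  = 0

range : ℕ → ℕ → List ℕ
range a b = map (a ℕ.+_) (upTo (suc b ∸ a))

xOf : ∀ {n} → Vec ℕ (suc n) → ℕ
xOf {n} e = sum (map (at e) (range 2 (n ∸ 1)))

weightOf : ∀ {n} → Vec ℕ (suc n) → ℕ
weightOf {n} e = sum (map (λ i → i ℕ.* at e i) (range 2 (n ∸ 1)))

InP : ∀ n → Vec ℕ (suc n) → Set
InP n e = at e 0 ≡ 0 × at e 1 ≡ 0 × at e n ≡ 0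
        × 3 ℕ.≤ xOf e
        × weightOf e ℕ.≤ (xOf e ∸ 1) ℕ.* n

-- Families of subsets of [n] (a family = a duplicate-free list of subsets)

Intersecting : ∀ {n} → List (Subset n) → Set
Intersecting F = ∀ {A B} → A ∈ₗ F → B ∈ₗ F → Nonempty (A ∩ B)

Trivial : ∀ {n} → List (Subset n) → Set
Trivial {n} F = ∃ λ (x : Fin n) → ∀ {A} → A ∈ₗ F → x ∈ A

profile : ∀ {n} → List (Subset n) → Vec ℕ (suc n)
profile {n} F = tabulate λ (i : Fin (suc n)) →
  length (filter (λ A → ∣ A ∣ ≟ Data.Fin.toℕ i) F)

InΛ : ∀ n → Vec ℕ (suc n) → Set
InΛ n v = Σ (List (Subset n)) λ F →
  Unique F × Intersecting F × ¬ Trivial F × profile F ≡ v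

ℕtoℚ : ℕ → ℚ
ℕtoℚ k = + k / 1

sumℚ : List ℚ → ℚ
sumℚ = foldr ℚ._+_ 0ℚ

ConvexCombOfOthers : ∀ {n} → (Vec ℕ (suc n) → Set) → Vec ℕ (suc n) → Set
ConvexCombOfOthers {n} S v =
  Σ (List (ℚ × Vec ℕ (suc n))) λ ws →
    All (λ { (c , w) → (0ℚ ℚ.< c) × S w × w ≢ v }) ws
  × sumℚ (map (λ { (c , _) → c }) ws) ≡ 1ℚ
  × (∀ (i : Fin (suc n)) →
       sumℚ (map (λ { (c , w) → c ℚ.* ℕtoℚ (lookup w i) }) ws) ≡ ℕtoℚ (lookup v i))

Extreme : ∀ {n} → (Vec ℕ (suc n) → Set) → Vec ℕ (suc n) → Set
Extreme S v = S v × ¬ ConvexCombOfOthers S v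

InΓe : ∀ n → Vec ℕ (suc n) → Set
InΓe n = Extreme (InP n)

-- Every point of P is the multiplicity vector of its size list (each i ∈ [2, n − 1] repeated e_i times),
-- and P consists exactly of the multiplicity vectors of size lists of length x ≥ 3 with total at most
-- (x − 1)n.  The profile of a non-trivial intersecting family that does not contain [n] is such a
-- vector: the members have sizes in [2, n − 1], there are at least three of them, and their complements
-- cover [n].  As e_n = 0, a convex combination of points of Λ giving e only uses such profiles, so it is
-- a convex combination of points of P, which extremality in P rules out.
--
-- Conversely, write the size list of e as s₁, s₂, s₃ followed by N.  Removing s₁ must leave P, for
-- otherwise e would be the midpoint of the vectors with s₁ removed and with s₁ doubled, both in P; this
-- forces Σ_{s ∈ N} (n − s) ≤ n − 3.  Now split [n] into {0, 1, 2} and a tail T.  The sets of sizes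
-- s₁, s₂, s₃ contain {0, 1, 2} minus one point each, those of sizes in N contain all of {0, 1, 2}, and
-- every set misses one run of consecutive points of T.  The runs of the sets from N are pairwise
-- disjoint, so these sets are distinct, and all runs together cover T because Σ sᵢ ≤ (x − 1)n; hence the
-- family is intersecting, non-trivial and has profile e.

module Submission where

open import Defs
open import Data.Bool using (if_then_else_)
open import Data.Empty using (⊥)
open import Data.Fin as Fin using (Fin; zero; suc; toℕ; fromℕ; fromℕ<; _↑ʳ_; _↑ˡ_; #_)
open import Data.Fin.Properties using (all?; toℕ<n; toℕ-fromℕ; toℕ-fromℕ<; fromℕ<-toℕ)
open import Data.Fin.Subset using (Subset; ⁅_⁆; inside; outside; ⊤; ∁; _∪_; ⋃; _⊆_; _∈_; _∉_; _∩_; ∣_∣; Nonempty)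
open import Data.Fin.Subset.Properties
  using (_∈?_; nonempty?; ∣p∣≤n; ∣⊥∣≡0; ∣⊤∣≡n; p⊆q⇒∣p∣≤∣q∣; p⊂q⇒∣p∣<∣q∣; ∣∁p∣≡n∸∣p∣; x∉p⇒x∈∁p; x∈p∪q⁺; x∈p∩q⁺; x∈p∩q⁻;
         x∈⁅y⁆⇒x≡y; ∣⁅x⁆∣≡1)
open import Data.List using (List; []; _∷_; _++_; [_]; map; filter; length; replicate; concatMap)
open import Data.List.Properties using (length-++; length-map; filter-++; filter-accept; filter-reject; filter-none; filter-some; map-cong; map-∘; map-id)
open import Data.List.Relation.Unary.All as All using (All; []; _∷_)
open import Data.List.Relation.Unary.All.Properties using (¬All⇒Any¬; ++⁺; replicate⁺; map⁺)
open import Data.List.Relation.Unary.Any as Any using (Any; here; there)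
open import Data.List.Relation.Unary.AllPairs using ([]; _∷_)
open import Data.List.Relation.Unary.Unique.Propositional using (Unique)
open import Data.List.Relation.Unary.Unique.Propositional.Properties using (upTo⁺)
import Data.List.Relation.Unary.Unique.Propositional.Properties as Unique
open import Data.List.Membership.Propositional renaming (_∈_ to _∈ₗ_; _∉_ to _∉ₗ_)
open import Data.List.Membership.Propositional.Properties using (∈-map⁺; ∈-map⁻; ∈-upTo⁺; ∈-upTo⁻)
open import Data.Nat as ℕ using (ℕ; zero; suc; _≡ᵇ_; _+_; _*_; _∸_; _≤_; _<_; _≟_; _≤?_; _<?_; z≤n; s≤s)
open import Data.Nat.Properties
open import Data.List.Membership.DecPropositional ℕ._≟_ using () renaming (_∈?_ to _∈ₗ?_)
open import Data.Nat.ListAction using (sum)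
open import Algebra.Properties.CommutativeSemigroup +-commutativeSemigroup using () renaming (interchange to +-interchange)
open import Data.Nat.Tactic.RingSolver using (solve-∀)
open import Data.Product using (_×_; ∃; _,_; proj₁; proj₂)
open import Data.Sum using (inj₁; inj₂)
open import Data.Vec as Vec using (Vec; lookup; tabulate; []; _∷_; here; there)
open import Data.Vec.Properties using (lookup∘tabulate; tabulate∘lookup; tabulate-cong; lookup-++ˡ; lookup-++ʳ; []=⇒lookup; lookup⇒[]=)
open import Function using (_∘_)
import Data.Integer as ℤ
import Data.Integer.Properties as ℤP
open import Data.Rational as ℚ using (ℚ; 0ℚ; 1ℚ; ½; mkℚ)
import Data.Rational.Properties as ℚP
import Data.Nat.Coprimality as Coprime
open import Relation.Binary.PropositionalEquality using (_≡_; _≢_; refl; sym; trans; cong; cong₂; subst; subst₂; module ≡-Reasoning)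
open import Relation.Nullary using (¬_; yes; no; contradiction)
open import Relation.Nullary.Decidable using (toWitness)

occ : ℕ → List ℕ → ℕ
occ k zs = length (filter (_≟ k) zs)

occ-++ : ∀ k xs ys → occ k (xs ++ ys) ≡ occ k xs + occ k ys
occ-++ k xs ys = trans (cong length (filter-++ (_≟ k) xs ys)) (length-++ (filter (_≟ k) xs))

occ-∷ : ∀ k z zs → occ k (z ∷ zs) ≡ occ k [ z ] + occ k zs
occ-∷ k z = occ-++ k [ z ]

occ-[k] : ∀ k → occ k [ k ] ≡ 1
occ-[k] k = cong length (filter-accept (_≟ k) refl)

occ-[z] : ∀ {k z} → z ≢ k → occ k [ z ] ≡ 0
occ-[z] {k} z≢k = cong length (filter-reject (_≟ k) z≢k)

occ-replicate : ∀ k r z → occ k (replicate r z) ≡ r * occ k [ z ]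
occ-replicate k zero    z = refl
occ-replicate k (suc r) z = trans (occ-∷ k z (replicate r z)) (cong (occ k [ z ] +_) (occ-replicate k r z))

occ-none : ∀ {k zs} → All (_≢ k) zs → occ k zs ≡ 0
occ-none {k} z≢k = cong length (filter-none (_≟ k) z≢k)

occ-pos : ∀ {k zs} → k ∈ₗ zs → 0 < occ k zs
occ-pos k∈zs = filter-some (_≟ _) (Any.map sym k∈zs)

sum-map-+ : ∀ (f g : ℕ → ℕ) R → sum (map (λ i → f i + g i) R) ≡ sum (map f R) + sum (map g R)
sum-map-+ f g []      = refl
sum-map-+ f g (r ∷ R) = trans (cong (f r + g r +_) (sum-map-+ f g R)) (+-interchange (f r) (g r) _ _)

sum-map-zero : ∀ {f : ℕ → ℕ} {R} → All (λ i → f i ≡ 0) R → sum (map f R) ≡ 0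
sum-map-zero []         = refl
sum-map-zero (p ∷ ps) = cong₂ _+_ p (sum-map-zero ps)

sum-map-*occ-[z] : ∀ (f : ℕ → ℕ) {z R} → Unique R → z ∈ₗ R → sum (map (λ i → f i * occ i [ z ]) R) ≡ f z
sum-map-*occ-[z] f {z} {r ∷ R} (r∉R ∷ _) (here refl) = begin
  f z * occ z [ z ] + sum (map (λ i → f i * occ i [ z ]) R) ≡⟨ cong₂ _+_ (cong (f z *_) (occ-[k] z)) (sum-map-zero (All.map vanish r∉R)) ⟩
  f z * 1 + 0                                              ≡⟨ trans (+-identityʳ _) (*-identityʳ (f z)) ⟩
  f z ∎
  where
  open ≡-Reasoning
  vanish : ∀ {i} → z ≢ i → f i * occ i [ z ] ≡ 0
  vanish {i} z≢i = trans (cong (f i *_) (occ-[z] z≢i)) (*-zeroʳ (f i))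
sum-map-*occ-[z] f {z} {r ∷ R} (r∉R ∷ R!) (there z∈R) = begin
  f r * occ r [ z ] + sum (map (λ i → f i * occ i [ z ]) R) ≡⟨ cong₂ _+_ (cong (f r *_) (occ-[z] (All.lookup r∉R z∈R ∘ sym)))
                                                                          (sum-map-*occ-[z] f R! z∈R) ⟩
  f r * 0 + f z                                            ≡⟨ cong (_+ f z) (*-zeroʳ (f r)) ⟩
  f z ∎
  where open ≡-Reasoning

sum-map-*occ : ∀ (f : ℕ → ℕ) {R} zs → Unique R → All (_∈ₗ R) zs → sum (map (λ i → f i * occ i zs) R) ≡ sum (map f zs)
sum-map-*occ f {R} []       _  _              = sum-map-zero (All.universal (λ i → *-zeroʳ (f i)) R)
sum-map-*occ f {R} (z ∷ zs) R! (z∈R ∷ zs⊆R) = begin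
  sum (map (λ i → f i * occ i (z ∷ zs)) R)                                  ≡⟨ cong sum (map-cong (λ i → trans (cong (f i *_) (occ-∷ i z zs)) (*-distribˡ-+ (f i) _ _)) R) ⟩
  sum (map (λ i → f i * occ i [ z ] + f i * occ i zs) R)                   ≡⟨ sum-map-+ _ _ R ⟩
  sum (map (λ i → f i * occ i [ z ]) R) + sum (map (λ i → f i * occ i zs) R) ≡⟨ cong₂ _+_ (sum-map-*occ-[z] f R! z∈R) (sum-map-*occ f zs R! zs⊆R) ⟩
  f z + sum (map f zs) ∎
  where open ≡-Reasoning

range-unique : ∀ a b → Unique (range a b)
range-unique a b = Unique.map⁺ (+-cancelˡ-≡ a _ _) (upTo⁺ _)

∈-range⁻ : ∀ {a b i} → i ∈ₗ range a b → a ≤ i × i ≤ b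
∈-range⁻ {a} {b} i∈R with j , j∈ , refl ← ∈-map⁻ (a +_) i∈R = m≤m+n a j , subst (_≤ b) (+-comm j a) j+a≤b
  where
  j<d : j < suc b ∸ a
  j<d = ∈-upTo⁻ j∈
  j+a≤b : j + a ≤ b
  j+a≤b = ≤-pred (m≤o∸n⇒m+n≤o (suc j) (<⇒≤ (m∸n≢0⇒n<m (m<n⇒n≢0 j<d))) j<d)

∈-range⁺ : ∀ {a b i} → a ≤ i → i ≤ b → i ∈ₗ range a b
∈-range⁺ {a} {b} {i} a≤i i≤b = subst (_∈ₗ range a b) (m+[n∸m]≡n a≤i) (∈-map⁺ (a +_) (∈-upTo⁺ i∸a<d))
  where
  i∸a<d : i ∸ a < suc b ∸ a
  i∸a<d = subst (_≤ suc b ∸ a) (+-∸-assoc 1 a≤i) (∸-monoˡ-≤ a (s≤s i≤b))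

expand : (ℕ → ℕ) → List ℕ → List ℕ
expand f = concatMap (λ i → replicate (f i) i)

All-expand : ∀ {P : ℕ → Set} f {R} → All P R → All P (expand f R)
All-expand f []       = []
All-expand f (p ∷ ps) = ++⁺ (replicate⁺ (f _) p) (All-expand f ps)

occ-expand-∉ : ∀ f {k} R → k ∉ₗ R → occ k (expand f R) ≡ 0
occ-expand-∉ f {k} []      _   = refl
occ-expand-∉ f {k} (r ∷ R) k∉R = begin
  occ k (replicate (f r) r ++ expand f R)      ≡⟨ occ-++ k (replicate (f r) r) _ ⟩
  occ k (replicate (f r) r) + occ k (expand f R) ≡⟨ cong₂ _+_ (occ-replicate k (f r) r) (occ-expand-∉ f R (k∉R ∘ there)) ⟩
  f r * occ k [ r ] + 0                         ≡⟨ cong (λ o → f r * o + 0) (occ-[z] (k∉R ∘ here ∘ sym)) ⟩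
  f r * 0 + 0                                   ≡⟨ cong (_+ 0) (*-zeroʳ (f r)) ⟩
  0 ∎
  where open ≡-Reasoning

occ-expand-∈ : ∀ f {k R} → Unique R → k ∈ₗ R → occ k (expand f R) ≡ f k
occ-expand-∈ f {k} {r ∷ R} (r∉R ∷ R!) k∈ = begin
  occ k (replicate (f r) r ++ expand f R)        ≡⟨ occ-++ k (replicate (f r) r) _ ⟩
  occ k (replicate (f r) r) + occ k (expand f R) ≡⟨ cong (_+ occ k (expand f R)) (occ-replicate k (f r) r) ⟩
  f r * occ k [ r ] + occ k (expand f R)         ≡⟨ split k∈ ⟩
  f k ∎
  where
  open ≡-Reasoning
  split : k ∈ₗ r ∷ R → f r * occ k [ r ] + occ k (expand f R) ≡ f k
  split (here refl) = trans (cong₂ _+_ (trans (cong (f k *_) (occ-[k] k)) (*-identityʳ (f k)))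
                                       (occ-expand-∉ f R (λ k∈R → All.lookup r∉R k∈R refl)))
                            (+-identityʳ (f k))
  split (there k∈R) = cong₂ _+_ (trans (cong (f r *_) (occ-[z] (All.lookup r∉R k∈R))) (*-zeroʳ (f r)))
                        (occ-expand-∈ f R! k∈R)

at-toℕ : ∀ {n} (v : Vec ℕ (suc n)) i → at v (toℕ i) ≡ lookup v i
at-toℕ {n} v i with toℕ i <? suc n
... | yes p = cong (lookup v) (fromℕ<-toℕ i p)
... | no ¬p = contradiction (toℕ<n i) ¬p

at-> : ∀ {n} (v : Vec ℕ (suc n)) {k} → n < k → at v k ≡ 0
at-> {n} v {k} n<k with k <? suc n
... | yes k≤n = contradiction (≤-pred k≤n) (<⇒≱ n<k)
... | no  _   = refl

at-tabulate : ∀ {n} (g : ℕ → ℕ) {k} → k ≤ n → at (tabulate {n = suc n} (g ∘ toℕ)) k ≡ g k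
at-tabulate {n} g {k} k≤n with k <? suc n
... | yes p = trans (lookup∘tabulate (g ∘ toℕ) (fromℕ< p)) (cong g (toℕ-fromℕ< p))
... | no ¬p = contradiction (s≤s k≤n) ¬p

at-ext : ∀ {n} {u v : Vec ℕ (suc n)} → (∀ k → at u k ≡ at v k) → u ≡ v
at-ext {u = u} {v} eq = begin
  u                  ≡⟨ tabulate∘lookup u ⟨
  tabulate (lookup u) ≡⟨ tabulate-cong (λ i → trans (sym (at-toℕ u i)) (trans (eq (toℕ i)) (at-toℕ v i))) ⟩
  tabulate (lookup v) ≡⟨ tabulate∘lookup v ⟩
  v ∎
  where open ≡-Reasoning

-- Since at is 0 beyond n, Counts v zs forces every element of zs to be at most n.
Counts : ∀ {n} → Vec ℕ (suc n) → List ℕ → Set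
Counts v zs = ∀ k → at v k ≡ occ k zs

countVec : ∀ n → List ℕ → Vec ℕ (suc n)
countVec n zs = tabulate (λ i → occ (toℕ i) zs)

counts-unique : ∀ {n} {u v : Vec ℕ (suc n)} {zs} → Counts u zs → Counts v zs → u ≡ v
counts-unique u≈zs v≈zs = at-ext (λ k → trans (u≈zs k) (sym (v≈zs k)))

countVec-counts : ∀ {n zs} → All (_≤ n) zs → Counts (countVec n zs) zs
countVec-counts {n} {zs} zs≤n k with k ≤? n
... | yes k≤n = at-tabulate (λ j → occ j zs) k≤n
... | no  k≰n = trans (at-> (countVec n zs) (≰⇒> k≰n))
                      (sym (occ-none (All.map (λ z≤ z≡k → k≰n (subst (_≤ n) z≡k z≤)) zs≤n)))

length-filter-size≡occ : ∀ {n} k (F : List (Subset n)) → length (filter (λ A → ∣ A ∣ ≟ k) F) ≡ occ k (map ∣_∣ F)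
length-filter-size≡occ k []      = refl
length-filter-size≡occ k (A ∷ F) with ∣ A ∣ ≟ k
... | yes p = trans (cong length (filter-accept (λ B → ∣ B ∣ ≟ k) {A} {F} p))
                    (trans (cong suc (length-filter-size≡occ k F))
                           (sym (cong length (filter-accept (_≟ k) {∣ A ∣} {map ∣_∣ F} p))))
... | no ¬p = trans (cong length (filter-reject (λ B → ∣ B ∣ ≟ k) {A} {F} ¬p))
                    (trans (length-filter-size≡occ k F)
                           (sym (cong length (filter-reject (_≟ k) {∣ A ∣} {map ∣_∣ F} ¬p))))

profile-counts : ∀ {n} (F : List (Subset n)) → Counts (profile F) (map ∣_∣ F)
profile-counts {n} F = subst (λ v → Counts v (map ∣_∣ F)) (sym profile≡countVec)
                             (countVec-counts (map⁺ (All.universal ∣p∣≤n F)))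
  where
  profile≡countVec : profile F ≡ countVec n (map ∣_∣ F)
  profile≡countVec = tabulate-cong (λ i → length-filter-size≡occ (toℕ i) F)

-- Size lists and the set P

ProperSize : ℕ → ℕ → Set
ProperSize n z = z ∈ₗ range 2 (n ∸ 1)

Admissible : ℕ → List ℕ → Set
Admissible n zs = All (ProperSize n) zs × 3 ≤ length zs × sum zs ≤ (length zs ∸ 1) * n

ProperSize-≢ : ∀ {n z} → ProperSize n z → z ≢ 0 × z ≢ 1 × z ≢ n
ProperSize-≢ {n} z∈R with ∈-range⁻ {2} {n ∸ 1} z∈R
... | 2≤z , z≤n∸1 = (λ { refl → contradiction 2≤z λ () })
                  , (λ { refl → contradiction 2≤z λ { (s≤s ()) } })
                  , (λ { refl → n≰n∸1 2≤z z≤n∸1 })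
  where
  n≰n∸1 : ∀ {n} → 2 ≤ n → n ≤ n ∸ 1 → ⊥
  n≰n∸1 (s≤s _) le = <-irrefl refl le

ProperSize-≤ : ∀ {n z} → ProperSize n z → z ≤ n
ProperSize-≤ {n} z∈R = ≤-trans (proj₂ (∈-range⁻ {2} {n ∸ 1} z∈R)) (m∸n≤m n 1)

module _ {n} {v : Vec ℕ (suc n)} {zs} (v≈zs : Counts v zs) (zs⊆R : All (ProperSize n) zs) where

  xOf-counts : xOf v ≡ length zs
  xOf-counts = begin
    sum (map (at v) R)                       ≡⟨ cong sum (map-cong (λ i → trans (v≈zs i) (sym (*-identityˡ _))) R) ⟩
    sum (map (λ i → 1 * occ i zs) R)         ≡⟨ sum-map-*occ (λ _ → 1) zs (range-unique 2 (n ∸ 1)) zs⊆R ⟩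
    sum (map (λ _ → 1) zs)                   ≡⟨ sum-ones zs ⟩
    length zs ∎
    where
    open ≡-Reasoning
    R = range 2 (n ∸ 1)
    sum-ones : ∀ xs → sum (map (λ _ → 1) xs) ≡ length xs
    sum-ones []       = refl
    sum-ones (_ ∷ xs) = cong suc (sum-ones xs)

  weightOf-counts : weightOf v ≡ sum zs
  weightOf-counts = begin
    sum (map (λ i → i * at v i) R)           ≡⟨ cong sum (map-cong (λ i → cong (i *_) (v≈zs i)) R) ⟩
    sum (map (λ i → i * occ i zs) R)         ≡⟨ sum-map-*occ (λ i → i) zs (range-unique 2 (n ∸ 1)) zs⊆R ⟩
    sum (map (λ i → i) zs)                   ≡⟨ cong sum (map-id zs) ⟩
    sum zs ∎
    where
    open ≡-Reasoning
    R = range 2 (n ∸ 1)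

counts⇒InP : ∀ {n} {v : Vec ℕ (suc n)} {zs} → Counts v zs → Admissible n zs → InP n v
counts⇒InP {n} {v} {zs} v≈zs (zs⊆R , 3≤len , sum≤) =
    absent (proj₁ ∘ ProperSize-≢ {n})
  , absent (proj₁ ∘ proj₂ ∘ ProperSize-≢ {n})
  , absent (proj₂ ∘ proj₂ ∘ ProperSize-≢ {n})
  , subst (3 ≤_) (sym (xOf-counts v≈zs zs⊆R)) 3≤len
  , subst₂ (λ w x → w ≤ (x ∸ 1) * n) (sym (weightOf-counts v≈zs zs⊆R)) (sym (xOf-counts v≈zs zs⊆R)) sum≤
  where
  absent : ∀ {k} → (∀ {z} → ProperSize n z → z ≢ k) → at v k ≡ 0
  absent {k} ≢k = trans (v≈zs k) (occ-none (All.map ≢k zs⊆R))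

at-∉ProperSize : ∀ {n} {e : Vec ℕ (suc n)} {k} → InP n e → ¬ ProperSize n k → at e k ≡ 0
at-∉ProperSize {k = zero}     (e₀ , _ , _ , _) _ = e₀
at-∉ProperSize {k = suc zero} (_ , e₁ , _ , _) _ = e₁
at-∉ProperSize {n} {e} {suc (suc k)} (_ , _ , eₙ , _) k∉R with suc (suc k) ≤? n ∸ 1
... | yes k≤n∸1 = contradiction (∈-range⁺ (s≤s (s≤s z≤n)) k≤n∸1) k∉R
... | no  k≰n∸1 with m≤n⇒m<n∨m≡n (≤-trans (m≤n+m∸n n 1) (≰⇒> k≰n∸1))
...   | inj₁ n<k  = at-> e n<k
...   | inj₂ refl = eₙ

InP-counts : ∀ {n} {e : Vec ℕ (suc n)} → InP n e → Counts e (expand (at e) (range 2 (n ∸ 1)))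
InP-counts {n} {e} e∈P k with k ∈ₗ? range 2 (n ∸ 1)
... | yes k∈R = sym (occ-expand-∈ (at e) (range-unique 2 (n ∸ 1)) k∈R)
... | no  k∉R = trans (at-∉ProperSize e∈P k∉R) (sym (occ-expand-∉ (at e) _ k∉R))

InP⇒Admissible : ∀ {n} {e : Vec ℕ (suc n)} → InP n e → Admissible n (expand (at e) (range 2 (n ∸ 1)))
InP⇒Admissible {n} {e} e∈P@(_ , _ , _ , 3≤x , w≤) =
    zs⊆R
  , subst (3 ≤_) x≡len 3≤x
  , subst₂ (λ w x → w ≤ (x ∸ 1) * n) (weightOf-counts e≈zs zs⊆R) x≡len w≤
  where
  zs⊆R = All-expand (at e) (All.tabulate (λ i∈R → i∈R))
  e≈zs = InP-counts {n} {e} e∈P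
  x≡len = xOf-counts {n} {e} e≈zs zs⊆R

-- Convex combinations

ℕtoℚ≡mkℚ : ∀ k → ℕtoℚ k ≡ mkℚ (ℤ.+ k) 0 (Coprime.sym (Coprime.1-coprimeTo k))
ℕtoℚ≡mkℚ k = ℚP.↥p/↧p≡p (mkℚ (ℤ.+ k) 0 _)

ℕtoℚ-+ : ∀ a b → ℕtoℚ (a + b) ≡ ℕtoℚ a ℚ.+ ℕtoℚ b
ℕtoℚ-+ a b rewrite ℕtoℚ≡mkℚ a | ℕtoℚ≡mkℚ b =
  sym (ℚP./-cong {p₁ = ℤ.+ a ℤ.* ℤ.+ 1 ℤ.+ ℤ.+ b ℤ.* ℤ.+ 1} {q₁ = 1} {p₂ = ℤ.+ (a + b)}
                 (cong₂ ℤ._+_ (ℤP.*-identityʳ (ℤ.+ a)) (ℤP.*-identityʳ (ℤ.+ b))) refl)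

½-midpoint : ∀ a b c → a + b ≡ c + c → ½ ℚ.* ℕtoℚ a ℚ.+ (½ ℚ.* ℕtoℚ b ℚ.+ 0ℚ) ≡ ℕtoℚ c
½-midpoint a b c a+b≡2c = begin
  ½ ℚ.* ℕtoℚ a ℚ.+ (½ ℚ.* ℕtoℚ b ℚ.+ 0ℚ) ≡⟨ cong (½ ℚ.* ℕtoℚ a ℚ.+_) (ℚP.+-identityʳ _) ⟩
  ½ ℚ.* ℕtoℚ a ℚ.+ ½ ℚ.* ℕtoℚ b           ≡⟨ ℚP.*-distribˡ-+ ½ (ℕtoℚ a) (ℕtoℚ b) ⟨
  ½ ℚ.* (ℕtoℚ a ℚ.+ ℕtoℚ b)               ≡⟨ cong (½ ℚ.*_) (trans (sym (ℕtoℚ-+ a b)) (trans (cong ℕtoℚ a+b≡2c) (ℕtoℚ-+ c c))) ⟩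
  ½ ℚ.* (ℕtoℚ c ℚ.+ ℕtoℚ c)               ≡⟨ ℚP.*-distribˡ-+ ½ (ℕtoℚ c) (ℕtoℚ c) ⟩
  ½ ℚ.* ℕtoℚ c ℚ.+ ½ ℚ.* ℕtoℚ c           ≡⟨ ℚP.*-distribʳ-+ (ℕtoℚ c) ½ ½ ⟨
  1ℚ ℚ.* ℕtoℚ c                           ≡⟨ ℚP.*-identityˡ (ℕtoℚ c) ⟩
  ℕtoℚ c ∎
  where open ≡-Reasoning

midpoint-convexComb : ∀ {n} {S : Vec ℕ (suc n) → Set} {u v w : Vec ℕ (suc n)} →
  S u → S w → u ≢ v → w ≢ v → (∀ k → at u k + at w k ≡ at v k + at v k) → ConvexCombOfOthers S v
midpoint-convexComb {u = u} {v} {w} u∈S w∈S u≢v w≢v mid =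
    (½ , u) ∷ (½ , w) ∷ []
  , (0<½ , u∈S , u≢v) ∷ (0<½ , w∈S , w≢v) ∷ []
  , refl
  , λ i → ½-midpoint (lookup u i) (lookup w i) (lookup v i)
            (subst₂ (λ x y → x + y ≡ lookup v i + lookup v i) (at-toℕ u i) (at-toℕ w i)
              (subst (λ x → at u (toℕ i) + at w (toℕ i) ≡ x + x) (at-toℕ v i) (mid (toℕ i))))
  where
  0<½ : 0ℚ ℚ.< ½
  0<½ = ℚP.positive⁻¹ ½

nonneg-+-≡0ˡ : ∀ {p q} → 0ℚ ℚ.≤ p → 0ℚ ℚ.≤ q → p ℚ.+ q ≡ 0ℚ → p ≡ 0ℚ
nonneg-+-≡0ˡ {p} {q} 0≤p 0≤q p+q≡0 = ℚP.≤-antisym p≤0 0≤p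
  where
  open ℚP.≤-Reasoning
  p≤0 : p ℚ.≤ 0ℚ
  p≤0 = begin
    p          ≡⟨ ℚP.+-identityʳ p ⟨
    p ℚ.+ 0ℚ   ≤⟨ ℚP.+-monoʳ-≤ p 0≤q ⟩
    p ℚ.+ q    ≡⟨ p+q≡0 ⟩
    0ℚ ∎

sumℚ-nonneg : ∀ {A : Set} (g : A → ℚ) {xs} → All (λ x → 0ℚ ℚ.≤ g x) xs → 0ℚ ℚ.≤ sumℚ (map g xs)
sumℚ-nonneg g []           = ℚP.≤-refl
sumℚ-nonneg g (0≤gx ∷ 0≤g) = ℚP.+-mono-≤ 0≤gx (sumℚ-nonneg g 0≤g)

sumℚ-nonneg-≡0 : ∀ {A : Set} (g : A → ℚ) {xs} → All (λ x → 0ℚ ℚ.≤ g x) xs →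
  sumℚ (map g xs) ≡ 0ℚ → All (λ x → g x ≡ 0ℚ) xs
sumℚ-nonneg-≡0 g []                   _      = []
sumℚ-nonneg-≡0 g {x ∷ xs} (0≤gx ∷ 0≤g) sum≡0 =
    nonneg-+-≡0ˡ 0≤gx 0≤Σ sum≡0
  ∷ sumℚ-nonneg-≡0 g 0≤g (nonneg-+-≡0ˡ 0≤Σ 0≤gx (trans (ℚP.+-comm _ (g x)) sum≡0))
  where
  0≤Σ = sumℚ-nonneg g 0≤g

*ℕtoℚ-nonneg : ∀ c k → 0ℚ ℚ.< c → 0ℚ ℚ.≤ c ℚ.* ℕtoℚ k
*ℕtoℚ-nonneg c k 0<c = ℚP.nonNegative⁻¹ (c ℚ.* ℕtoℚ k)
  {{ℚP.nonNeg*nonNeg⇒nonNeg c {{ℚP.pos⇒nonNeg c {{ℚ.positive 0<c}}}} (ℕtoℚ k) {{ℚP.normalize-nonNeg k 1}}}}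

*ℕtoℚ-≡0 : ∀ c k → 0ℚ ℚ.< c → c ℚ.* ℕtoℚ k ≡ 0ℚ → k ≡ 0
*ℕtoℚ-≡0 c zero    0<c _  = refl
*ℕtoℚ-≡0 c (suc k) 0<c eq = contradiction (sym eq) (ℚP.<⇒≢ (ℚP.positive⁻¹ (c ℚ.* ℕtoℚ (suc k))
  {{ℚP.pos*pos⇒pos c {{ℚ.positive 0<c}} (ℕtoℚ (suc k)) {{ℚP.normalize-pos (suc k) 1}}}}))

-- The coefficients are positive and the coordinates non-negative, so every point used vanishes at i.
convexComb-face : ∀ {n} {S T : Vec ℕ (suc n) → Set} {v} (i : Fin (suc n)) → lookup v i ≡ 0 →
  (∀ {w} → S w → lookup w i ≡ 0 → T w) → ConvexCombOfOthers S v → ConvexCombOfOthers T v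
convexComb-face {v = v} i vᵢ≡0 S∧0⇒T (ws , terms , total , coords) =
  ws , All.zipWith (λ { {c , w} ((0<c , w∈S , w≢v) , wᵢ≡0) → 0<c , S∧0⇒T w∈S wᵢ≡0 , w≢v }) (terms , on-face)
  , total , coords
  where
  g : ℚ × Vec ℕ _ → ℚ
  g (c , w) = c ℚ.* ℕtoℚ (lookup w i)
  on-face : All (λ x → lookup (proj₂ x) i ≡ 0) ws
  on-face = All.zipWith (λ { {c , w} ((0<c , _ , _) , gx≡0) → *ℕtoℚ-≡0 c (lookup w i) 0<c gx≡0 })
              (terms , sumℚ-nonneg-≡0 g (All.map (λ { {c , w} (0<c , _ , _) → *ℕtoℚ-nonneg c (lookup w i) 0<c }) terms)
                                        (trans (coords i) (cong ℕtoℚ vᵢ≡0)))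

counts-∷-≢ : ∀ {n} {u v : Vec ℕ (suc n)} {j zs} → Counts u zs → Counts v (j ∷ zs) → u ≢ v
counts-∷-≢ {j = j} {zs} u≈zs v≈jzs refl = 1+n≢n (sym (begin
  occ j zs            ≡⟨ trans (sym (u≈zs j)) (v≈jzs j) ⟩
  occ j (j ∷ zs)      ≡⟨ occ-∷ j j zs ⟩
  occ j [ j ] + occ j zs ≡⟨ cong (_+ occ j zs) (occ-[k] j) ⟩
  suc (occ j zs) ∎))
  where open ≡-Reasoning

occ-midpoint : ∀ k j zs → occ k zs + occ k (j ∷ j ∷ zs) ≡ occ k (j ∷ zs) + occ k (j ∷ zs)
occ-midpoint k j zs = begin
  occ k zs + occ k (j ∷ j ∷ zs)                       ≡⟨ cong (occ k zs +_) (trans (occ-∷ k j (j ∷ zs)) (cong (occ k [ j ] +_) (occ-∷ k j zs))) ⟩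
  occ k zs + (occ k [ j ] + (occ k [ j ] + occ k zs)) ≡⟨ rearrange (occ k zs) (occ k [ j ]) ⟩
  (occ k [ j ] + occ k zs) + (occ k [ j ] + occ k zs) ≡⟨ cong₂ _+_ (occ-∷ k j zs) (occ-∷ k j zs) ⟨
  occ k (j ∷ zs) + occ k (j ∷ zs) ∎
  where
  open ≡-Reasoning
  rearrange : ∀ a b → a + (b + (b + a)) ≡ (b + a) + (b + a)
  rearrange = solve-∀

-- Otherwise v would be the midpoint of the multiplicity vectors of zs and j ∷ j ∷ zs, both in P.
extreme-sum> : ∀ {n} {v : Vec ℕ (suc n)} {j zs} → Extreme (InP n) v → Counts v (j ∷ zs) →
  Admissible n (j ∷ zs) → 3 ≤ length zs → (length zs ∸ 1) * n < sum zs
extreme-sum> {n} {v} {j} {zs} (_ , not-comb) v≈jzs (j∈R ∷ zs⊆R , _ , jzs-sum≤) 3≤len =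
  ≰⇒> λ zs-sum≤ → not-comb (midpoint-convexComb {S = InP n}
    (counts⇒InP {zs = zs} u≈zs (zs⊆R , 3≤len , zs-sum≤))
    (counts⇒InP {zs = j ∷ j ∷ zs} w≈jjzs (j∈R ∷ j∈R ∷ zs⊆R , m≤n⇒m≤1+n (m≤n⇒m≤1+n 3≤len) , +-mono-≤ (ProperSize-≤ j∈R) jzs-sum≤))
    (counts-∷-≢ {j = j} {zs} u≈zs v≈jzs)
    (counts-∷-≢ {j = j} {j ∷ zs} v≈jzs w≈jjzs ∘ sym)
    λ k → trans (cong₂ _+_ (u≈zs k) (w≈jjzs k)) (trans (occ-midpoint k j zs) (sym (cong₂ _+_ (v≈jzs k) (v≈jzs k)))))
  where
  u = countVec n zs
  w = countVec n (j ∷ j ∷ zs)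
  u≈zs : Counts u zs
  u≈zs = countVec-counts (All.map ProperSize-≤ zs⊆R)
  w≈jjzs : Counts w (j ∷ j ∷ zs)
  w≈jjzs = countVec-counts (All.map ProperSize-≤ (j∈R ∷ j∈R ∷ zs⊆R))

-- Non-trivial intersecting families

⁅x⁆⊆ : ∀ {n} {x : Fin n} {A} → x ∈ A → ⁅ x ⁆ ⊆ A
⁅x⁆⊆ {x = x} x∈A z∈⁅x⁆ = subst (_∈ _) (sym (x∈⁅y⁆⇒x≡y x z∈⁅x⁆)) x∈A

∈⇒1≤∣∣ : ∀ {n} {x : Fin n} {A} → x ∈ A → 1 ≤ ∣ A ∣
∈⇒1≤∣∣ {x = x} x∈A = subst (_≤ _) (∣⁅x⁆∣≡1 x) (p⊆q⇒∣p∣≤∣q∣ (⁅x⁆⊆ x∈A))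

∣∣≡1⇒≡ : ∀ {n} {x y : Fin n} {A} → ∣ A ∣ ≡ 1 → x ∈ A → y ∈ A → x ≡ y
∣∣≡1⇒≡ {x = x} {y} ∣A∣≡1 x∈A y∈A with x Fin.≟ y
... | yes x≡y = x≡y
... | no  x≢y = contradiction (p⊂q⇒∣p∣<∣q∣ (⁅x⁆⊆ x∈A , y , y∈A , x≢y ∘ sym ∘ x∈⁅y⁆⇒x≡y x))
                             (subst₂ (λ a b → ¬ a < b) (sym (∣⁅x⁆∣≡1 x)) (sym ∣A∣≡1) (<-irrefl refl))

∣p∪q∣≤∣p∣+∣q∣ : ∀ {n} (p q : Subset n) → ∣ p ∪ q ∣ ≤ ∣ p ∣ + ∣ q ∣
∣p∪q∣≤∣p∣+∣q∣ []            []            = z≤n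
∣p∪q∣≤∣p∣+∣q∣ (inside  ∷ p) (inside  ∷ q) = s≤s (≤-trans (∣p∪q∣≤∣p∣+∣q∣ p q) (+-monoʳ-≤ ∣ p ∣ (n≤1+n ∣ q ∣)))
∣p∪q∣≤∣p∣+∣q∣ (inside  ∷ p) (outside ∷ q) = s≤s (∣p∪q∣≤∣p∣+∣q∣ p q)
∣p∪q∣≤∣p∣+∣q∣ (outside ∷ p) (inside  ∷ q) = subst (suc ∣ p ∪ q ∣ ≤_) (sym (+-suc ∣ p ∣ ∣ q ∣)) (s≤s (∣p∪q∣≤∣p∣+∣q∣ p q))
∣p∪q∣≤∣p∣+∣q∣ (outside ∷ p) (outside ∷ q) = ∣p∪q∣≤∣p∣+∣q∣ p q

∣⋃ps∣≤sum : ∀ {n} (ps : List (Subset n)) → ∣ ⋃ ps ∣ ≤ sum (map ∣_∣ ps)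
∣⋃ps∣≤sum {n} []       = ≤-reflexive (∣⊥∣≡0 n)
∣⋃ps∣≤sum     (p ∷ ps) = ≤-trans (∣p∪q∣≤∣p∣+∣q∣ p (⋃ ps)) (+-monoʳ-≤ ∣ p ∣ (∣⋃ps∣≤sum ps))

missed-by-some : ∀ {n} {F : List (Subset n)} → ¬ Trivial F → ∀ x → Any (x ∉_) F
missed-by-some {F = F} non-trivial x with All.all? (x ∈?_) F
... | yes x∈all = contradiction (x , λ {_} A∈F → All.lookup x∈all A∈F) non-trivial
... | no  ¬x∈all = ¬All⇒Any¬ (x ∈?_) F ¬x∈all

complements-cover : ∀ {n} {F : List (Subset n)} → ¬ Trivial F → n ≤ sum (map (n ∸_) (map ∣_∣ F))
complements-cover {n} {F} non-trivial = begin
  n                              ≡⟨ ∣⊤∣≡n n ⟨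
  ∣ ⊤ {n} ∣                      ≤⟨ p⊆q⇒∣p∣≤∣q∣ {p = ⊤} (λ {x} _ → ∈-⋃∁ (missed-by-some non-trivial x)) ⟩
  ∣ ⋃ (map ∁ F) ∣                ≤⟨ ∣⋃ps∣≤sum (map ∁ F) ⟩
  sum (map ∣_∣ (map ∁ F))        ≡⟨ cong sum (trans (sym (map-∘ F)) (trans (map-cong ∣∁p∣≡n∸∣p∣ F) (map-∘ F))) ⟩
  sum (map (n ∸_) (map ∣_∣ F)) ∎
  where
  open ≤-Reasoning
  ∈-⋃∁ : ∀ {x} {G : List (Subset n)} → Any (x ∉_) G → x ∈ ⋃ (map ∁ G)
  ∈-⋃∁ (here x∉A)  = x∈p∪q⁺ (inj₁ (x∉p⇒x∈∁p x∉A))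
  ∈-⋃∁ (there x∉G) = x∈p∪q⁺ (inj₂ (∈-⋃∁ x∉G))

intersecting-non-trivial⇒2≤∣∣ : ∀ {n} {F : List (Subset n)} {A} → Intersecting F → ¬ Trivial F → A ∈ₗ F → 2 ≤ ∣ A ∣
intersecting-non-trivial⇒2≤∣∣ {F = F} {A} intersecting non-trivial A∈F
  with x , x∈A∩A ← intersecting A∈F A∈F = ≤∧≢⇒< (∈⇒1≤∣∣ x∈A) λ 1≡∣A∣ → non-trivial (x , λ {B} B∈F → x∈ 1≡∣A∣ B∈F)
  where
  x∈A = proj₁ (x∈p∩q⁻ A A x∈A∩A)
  x∈ : 1 ≡ ∣ A ∣ → ∀ {B} → B ∈ₗ F → x ∈ B
  x∈ 1≡∣A∣ {B} B∈F with y , y∈A∩B ← intersecting A∈F B∈F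
    = subst (_∈ B) (∣∣≡1⇒≡ (sym 1≡∣A∣) (proj₁ (x∈p∩q⁻ A B y∈A∩B)) x∈A) (proj₂ (x∈p∩q⁻ A B y∈A∩B))

intersecting-non-trivial⇒3≤length : ∀ {n} {F : List (Subset (suc n))} → Intersecting F → ¬ Trivial F → 3 ≤ length F
intersecting-non-trivial⇒3≤length {F = []} _ non-trivial = contradiction (zero , λ ()) non-trivial
intersecting-non-trivial⇒3≤length {F = A ∷ []} intersecting non-trivial
  with x , x∈ ← intersecting (here refl) (here refl)
  = contradiction (x , λ { (here refl) → proj₁ (x∈p∩q⁻ A A x∈) }) non-trivial
intersecting-non-trivial⇒3≤length {F = A ∷ B ∷ []} intersecting non-trivial
  with x , x∈ ← intersecting (here refl) (there (here refl))
  = contradiction (x , λ { (here refl) → proj₁ (x∈p∩q⁻ A B x∈) ; (there (here refl)) → proj₂ (x∈p∩q⁻ A B x∈) }) non-trivial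
intersecting-non-trivial⇒3≤length {F = _ ∷ _ ∷ _ ∷ _} _ _ = s≤s (s≤s (s≤s z≤n))

sum-∸+sum : ∀ {n} zs → All (_≤ n) zs → sum (map (n ∸_) zs) + sum zs ≡ length zs * n
sum-∸+sum         []       []           = refl
sum-∸+sum {n} (z ∷ zs) (z≤ ∷ zs≤) = begin
  (n ∸ z + sum (map (n ∸_) zs)) + (z + sum zs) ≡⟨ +-interchange (n ∸ z) _ z _ ⟩
  (n ∸ z + z) + (sum (map (n ∸_) zs) + sum zs) ≡⟨ cong₂ _+_ (m∸n+n≡m z≤) (sum-∸+sum zs zs≤) ⟩
  n + length zs * n ∎
  where open ≡-Reasoning

gaps≥n⇒sum≤ : ∀ {n} zs → All (_≤ n) zs → n ≤ sum (map (n ∸_) zs) → sum zs ≤ (length zs ∸ 1) * n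
gaps≥n⇒sum≤ {n} zs zs≤n n≤gaps = begin
  sum zs                      ≤⟨ m+n≤o⇒m≤o∸n (sum zs) sum+n≤ ⟩
  length zs * n ∸ n           ≡⟨ cong (length zs * n ∸_) (*-identityˡ n) ⟨
  length zs * n ∸ 1 * n       ≡⟨ *-distribʳ-∸ n (length zs) 1 ⟨
  (length zs ∸ 1) * n ∎
  where
  open ≤-Reasoning
  sum+n≤ : sum zs + n ≤ length zs * n
  sum+n≤ = begin
    sum zs + n                       ≤⟨ +-monoʳ-≤ (sum zs) n≤gaps ⟩
    sum zs + sum (map (n ∸_) zs)     ≡⟨ +-comm (sum zs) _ ⟩
    sum (map (n ∸_) zs) + sum zs     ≡⟨ sum-∸+sum zs zs≤n ⟩
    length zs * n ∎

InΛ∧last≡0⇒InP : ∀ {n} {w : Vec ℕ (2 + n)} → InΛ (suc n) w → lookup w (fromℕ (suc n)) ≡ 0 → InP (suc n) w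
InΛ∧last≡0⇒InP {n′} (F , _ , intersecting , non-trivial , refl) last≡0 =
  counts⇒InP {zs = sizes} (profile-counts F)
    ( map⁺ (All.tabulate (λ A∈F → ∈-range⁺ (intersecting-non-trivial⇒2≤∣∣ intersecting non-trivial A∈F) (∣∣≤n∸1 A∈F)))
    , subst (3 ≤_) (sym (length-map ∣_∣ F)) (intersecting-non-trivial⇒3≤length intersecting non-trivial)
    , gaps≥n⇒sum≤ sizes (map⁺ (All.universal ∣p∣≤n F)) (complements-cover non-trivial))
  where
  n = suc n′
  sizes = map ∣_∣ F
  no-full : occ n sizes ≡ 0
  no-full = trans (sym (profile-counts F n))
                  (trans (cong (at (profile F)) (sym (toℕ-fromℕ n))) (trans (at-toℕ (profile F) (fromℕ n)) last≡0))
  ∣∣≤n∸1 : ∀ {A} → A ∈ₗ F → ∣ A ∣ ≤ n ∸ 1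
  ∣∣≤n∸1 {A} A∈F = m+n≤o⇒m≤o∸n ∣ A ∣ (subst (_≤ n) (+-comm 1 ∣ A ∣) (≤∧≢⇒< (∣p∣≤n A) ∣A∣≢n))
    where
    ∣A∣≢n : ∣ A ∣ ≢ n
    ∣A∣≢n ∣A∣≡n = contradiction no-full (m<n⇒n≢0 (occ-pos (subst (_∈ₗ sizes) ∣A∣≡n (∈-map⁺ ∣_∣ A∈F))))

-- Realising size lists by families

holed : (m q a : ℕ) → Subset m
holed zero    q       a       = []
holed (suc m) (suc q) a       = inside  ∷ holed m q a
holed (suc m) zero    zero    = inside  ∷ holed m zero zero
holed (suc m) zero    (suc a) = outside ∷ holed m zero a

∣holed∣ : ∀ m q a → q + a ≤ m → ∣ holed m q a ∣ + a ≡ m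
∣holed∣ zero    zero    zero    _         = refl
∣holed∣ (suc m) (suc q) a       (s≤s le)  = cong suc (∣holed∣ m q a le)
∣holed∣ (suc m) zero    zero    _         = cong suc (∣holed∣ m zero zero z≤n)
∣holed∣ (suc m) zero    (suc a) (s≤s le)  = trans (+-suc _ a) (cong suc (∣holed∣ m zero a le))

holed-∉ : ∀ m q a {t : Fin m} → q ≤ toℕ t → toℕ t < q + a → t ∉ holed m q a
holed-∉ (suc m) (suc q) a       {suc t} (s≤s q≤t) (s≤s t<) (there t∈) = holed-∉ m q a q≤t t< t∈
holed-∉ (suc m) zero    (suc a) {suc t} _         (s≤s t<) (there t∈) = holed-∉ m zero a z≤n t< t∈

holed-∈ : ∀ m q a {t : Fin m} → toℕ t < q → t ∈ holed m q a
holed-∈ (suc m) (suc q) a {zero}  _        = here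
holed-∈ (suc m) (suc q) a {suc t} (s≤s t<) = there (holed-∈ m q a t<)

-- {0, 1, 2} without c; in particular coreSet (# 3) is all of {0, 1, 2}.
coreSet : Fin 4 → Subset 3
coreSet c = tabulate (λ i → if toℕ i ≡ᵇ toℕ c then outside else inside)

cores-meet : ∀ c d → Nonempty (coreSet c ∩ coreSet d)
cores-meet = toWitness {a? = all? λ c → all? λ d → nonempty? (coreSet c ∩ coreSet d)} _

∣p++q∣ : ∀ {k l} (p : Subset k) (q : Subset l) → ∣ p Vec.++ q ∣ ≡ ∣ p ∣ + ∣ q ∣
∣p++q∣ []            q = refl
∣p++q∣ (inside  ∷ p) q = cong suc (∣p++q∣ p q)
∣p++q∣ (outside ∷ p) q = ∣p++q∣ p q

∈-++⁺ˡ : ∀ {k l} {x : Fin k} (p : Subset k) (q : Subset l) → x ∈ p → x ↑ˡ l ∈ p Vec.++ q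
∈-++⁺ˡ {x = x} p q x∈p = lookup⇒[]= _ _ (trans (lookup-++ˡ p q x) ([]=⇒lookup x∈p))

∈-++⁺ʳ : ∀ {k l} {t : Fin l} (p : Subset k) (q : Subset l) → t ∈ q → k ↑ʳ t ∈ p Vec.++ q
∈-++⁺ʳ {t = t} p q t∈q = lookup⇒[]= _ _ (trans (lookup-++ʳ p q t) ([]=⇒lookup t∈q))

∈-++⁻ʳ : ∀ {k l} {t : Fin l} (p : Subset k) (q : Subset l) → k ↑ʳ t ∈ p Vec.++ q → t ∈ q
∈-++⁻ʳ {t = t} p q t∈ = lookup⇒[]= _ _ (trans (sym (lookup-++ʳ p q t)) ([]=⇒lookup t∈))

++-meet : ∀ {k l} (p q : Subset k) (r s : Subset l) → Nonempty (p ∩ q) → Nonempty ((p Vec.++ r) ∩ (q Vec.++ s))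
++-meet {l = l} p q r s (x , x∈p∩q) with x∈p , x∈q ← x∈p∩q⁻ p q x∈p∩q =
  x ↑ˡ l , x∈p∩q⁺ (∈-++⁺ˡ p r x∈p , ∈-++⁺ˡ q s x∈q)

module _ (m : ℕ) where

  -- The number of the last m points missed by a set with core c and size s.
  gap : Fin 4 × ℕ → ℕ
  gap (c , s) = ∣ coreSet c ∣ + m ∸ s

  totalGap : List (Fin 4 × ℕ) → ℕ
  totalGap sp = sum (map gap sp)

  -- Each set gets its hole just below the holes of the sets after it.
  build : List (Fin 4 × ℕ) → List (Subset (3 + m))
  build []       = []
  build (x ∷ sp) = (coreSet (proj₁ x) Vec.++ holed m (m ∸ totalGap (x ∷ sp)) (gap x)) ∷ build sp

  ∈-build⁻ : ∀ {sp A} → A ∈ₗ build sp → ∃ λ x → x ∈ₗ sp × ∃ λ h → A ≡ coreSet (proj₁ x) Vec.++ h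
  ∈-build⁻ {x ∷ sp} (here refl) = x , here refl , _ , refl
  ∈-build⁻ {x ∷ sp} (there A∈)  with y , y∈ , h , A≡ ← ∈-build⁻ A∈ = y , there y∈ , h , A≡

  build-intersecting : ∀ sp → Intersecting (build sp)
  build-intersecting sp A∈ B∈ with x , _ , _ , refl ← ∈-build⁻ {sp} A∈ | y , _ , _ , refl ← ∈-build⁻ {sp} B∈ =
    ++-meet (coreSet (proj₁ x)) (coreSet (proj₁ y)) _ _ (cores-meet (proj₁ x) (proj₁ y))

  Fits : Fin 4 × ℕ → Set
  Fits (c , s) = gap (c , s) ≤ m × s ≤ ∣ coreSet c ∣ + m

  build-sizes : ∀ {sp} → All Fits sp → map ∣_∣ (build sp) ≡ map proj₂ sp
  build-sizes []                                 = refl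
  build-sizes {(c , s) ∷ sp} ((g≤m , s≤) ∷ fits) = cong₂ _∷_ size (build-sizes fits)
    where
    g = gap (c , s)
    k = ∣ coreSet c ∣
    h = holed m (m ∸ (g + totalGap sp)) g
    ∣h∣+g≡m : ∣ h ∣ + g ≡ m
    ∣h∣+g≡m = ∣holed∣ m _ g (≤-trans (+-monoˡ-≤ g (∸-monoʳ-≤ m (m≤m+n g (totalGap sp)))) (≤-reflexive (m∸n+n≡m g≤m)))
    size : ∣ coreSet c Vec.++ h ∣ ≡ s
    size = trans (∣p++q∣ (coreSet c) h) (+-cancelʳ-≡ g _ s (begin
      (k + ∣ h ∣) + g ≡⟨ +-assoc k ∣ h ∣ g ⟩
      k + (∣ h ∣ + g) ≡⟨ cong (k +_) ∣h∣+g≡m ⟩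
      k + m           ≡⟨ m∸n+n≡m s≤ ⟨
      g + s           ≡⟨ +-comm g s ⟩
      s + g ∎))
      where open ≡-Reasoning

  build-∈-below : ∀ {sp A} (t : Fin m) → toℕ t < m ∸ totalGap sp → A ∈ₗ build sp → 3 ↑ʳ t ∈ A
  build-∈-below {x ∷ sp} t t< (here refl) = ∈-++⁺ʳ (coreSet (proj₁ x)) _ (holed-∈ m _ (gap x) t<)
  build-∈-below {x ∷ sp} t t< (there A∈) = build-∈-below t (<-≤-trans t< (∸-monoʳ-≤ m (m≤n+m _ (gap x)))) A∈

  build-unique : ∀ {sp} → All (λ x → 1 ≤ gap x) sp → totalGap sp ≤ m → Unique (build sp)
  build-unique []                            _       = []
  build-unique {x ∷ sp} (1≤g ∷ gaps-pos) total≤m =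
    All.tabulate head≢ ∷ build-unique gaps-pos (≤-trans (m≤n+m _ (gap x)) total≤m)
    where
    T = totalGap sp
    q = m ∸ (gap x + T)
    q<m : q < m
    q<m = ∸-monoʳ-< (≤-trans 1≤g (m≤m+n _ T)) total≤m
    t = fromℕ< q<m
    t≡q : toℕ t ≡ q
    t≡q = toℕ-fromℕ< q<m
    t∉head : 3 ↑ʳ t ∉ coreSet (proj₁ x) Vec.++ holed m q (gap x)
    t∉head = holed-∉ m q (gap x) (≤-reflexive (sym t≡q)) (subst (_< q + gap x) (sym t≡q) (subst (_≤ q + gap x) (+-comm q 1) (+-monoʳ-≤ q 1≤g)))
           ∘ ∈-++⁻ʳ (coreSet (proj₁ x)) _
    t-below-rest : toℕ t < m ∸ T
    t-below-rest = subst (_< m ∸ T) (sym t≡q) (∸-monoʳ-< (+-monoˡ-≤ T 1≤g) total≤m)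
    head≢ : ∀ {B} → B ∈ₗ build sp → _ ≢ B
    head≢ B∈ refl = t∉head (build-∈-below t t-below-rest B∈)

  build-covers : ∀ {sp} (t : Fin m) → m ∸ totalGap sp ≤ toℕ t → ∃ λ A → A ∈ₗ build sp × 3 ↑ʳ t ∉ A
  build-covers {[]}     t m≤t = contradiction (toℕ<n t) (≤⇒≯ m≤t)
  build-covers {x ∷ sp} t q≤t with m ∸ totalGap sp ≤? toℕ t
  ... | yes le = let A , A∈ , t∉A = build-covers t le in A , there A∈ , t∉A
  ... | no  gt = _ , here refl , holed-∉ m _ (gap x) q≤t t<q+g ∘ ∈-++⁻ʳ (coreSet (proj₁ x)) _
    where
    T = totalGap sp
    t<q+g : toℕ t < m ∸ (gap x + T) + gap x
    t<q+g = <-≤-trans (≰⇒> gt) (begin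
      m ∸ T                     ≤⟨ m≤n+m∸n (m ∸ T) (gap x) ⟩
      gap x + (m ∸ T ∸ gap x)   ≡⟨ cong (gap x +_) (trans (∸-+-assoc m T (gap x)) (cong (m ∸_) (+-comm T (gap x)))) ⟩
      gap x + (m ∸ (gap x + T)) ≡⟨ +-comm (gap x) _ ⟩
      m ∸ (gap x + T) + gap x ∎)
      where open ≤-Reasoning

  familySpec : ℕ → ℕ → ℕ → List ℕ → List (Fin 4 × ℕ)
  familySpec s₁ s₂ s₃ N = (# 0 , s₁) ∷ (# 1 , s₂) ∷ (# 2 , s₃) ∷ map (# 3 ,_) N

  family-realises : ∀ {s₁ s₂ s₃ N} → All (ProperSize (3 + m)) (s₁ ∷ s₂ ∷ s₃ ∷ N) →
    sum (map (3 + m ∸_) N) ≤ m → m ≤ totalGap (familySpec s₁ s₂ s₃ N) →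
    let F = build (familySpec s₁ s₂ s₃ N) in
    Unique F × Intersecting F × ¬ Trivial F × map ∣_∣ F ≡ s₁ ∷ s₂ ∷ s₃ ∷ N
  family-realises {s₁} {s₂} {s₃} {N} (s₁∈R ∷ s₂∈R ∷ s₃∈R ∷ N⊆R) fulls-gap≤m m≤gap =
      ( ((λ ()) ∷ (λ ()) ∷ ≢-fulls (λ ())) ∷ ((λ ()) ∷ ≢-fulls (λ ())) ∷ ≢-fulls (λ ())
      ∷ build-unique (proj₂ fulls-fit) (subst (_≤ m) fulls-totalGap fulls-gap≤m))
    , build-intersecting spec
    , non-trivial
    , trans (build-sizes {spec} (core-fits {# 0} refl s₁∈R ∷ core-fits {# 1} refl s₂∈R ∷ core-fits {# 2} refl s₃∈R ∷ proj₁ fulls-fit))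
            (cong (λ xs → s₁ ∷ s₂ ∷ s₃ ∷ xs) (trans (sym (map-∘ N)) (map-id N)))
    where
    spec = familySpec s₁ s₂ s₃ N
    fulls = map (# 3 ,_) N

    bounds : ∀ {s} → ProperSize (3 + m) s → 2 ≤ s × s ≤ 2 + m
    bounds = ∈-range⁻ {2} {2 + m}

    core-fits : ∀ {c s} → ∣ coreSet c ∣ ≡ 2 → ProperSize (3 + m) s → Fits (c , s)
    core-fits {c} {s} eq s∈R = subst (λ k → k + m ∸ s ≤ m × s ≤ k + m) (sym eq)
                                         (∸-monoʳ-≤ (2 + m) (proj₁ (bounds s∈R)) , proj₂ (bounds s∈R))

    fulls-totalGap : sum (map (3 + m ∸_) N) ≡ totalGap fulls
    fulls-totalGap = cong sum (map-∘ N)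

    fulls-fit : All Fits fulls × All (λ x → 1 ≤ gap x) fulls
    fulls-fit = go N⊆R fulls-gap≤m
      where
      go : ∀ {N} → All (ProperSize (3 + m)) N → sum (map (3 + m ∸_) N) ≤ m →
           All Fits (map (# 3 ,_) N) × All (λ x → 1 ≤ gap x) (map (# 3 ,_) N)
      go []                 _  = [] , []
      go {s ∷ N} (s∈R ∷ N⊆R) le =
        let fits , pos = go N⊆R (≤-trans (m≤n+m _ (3 + m ∸ s)) le)
        in  (≤-trans (m≤m+n _ _) le , m≤n⇒m≤1+n (proj₂ (bounds s∈R))) ∷ fits
          , m+n≤o⇒m≤o∸n 1 (s≤s (proj₂ (bounds s∈R))) ∷ pos

    full-core : ∀ {B} → B ∈ₗ build fulls → ∃ λ h → B ≡ coreSet (# 3) Vec.++ h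
    full-core B∈ with y , y∈ , h , refl ← ∈-build⁻ {fulls} B∈ with s , _ , refl ← ∈-map⁻ (# 3 ,_) y∈ = h , refl

    ≢-fulls : ∀ {A} → (∀ {h} → A ≢ coreSet (# 3) Vec.++ h) → All (A ≢_) (build fulls)
    ≢-fulls A≢full = All.tabulate λ B∈ A≡B → A≢full (trans A≡B (proj₂ (full-core B∈)))

    non-trivial : ¬ Trivial (build spec)
    non-trivial (zero , 0∈all)                = contradiction (0∈all (here refl)) λ ()
    non-trivial (suc zero , 1∈all)            = contradiction (1∈all (there (here refl))) λ { (there ()) }
    non-trivial (suc (suc zero) , 2∈all)      = contradiction (2∈all (there (there (here refl)))) λ { (there (there ())) }
    non-trivial (suc (suc (suc t)) , t∈all)   =
      let A , A∈ , t∉A = build-covers {spec} t (subst (_≤ toℕ t) (sym (m≤n⇒m∸n≡0 m≤gap)) z≤n) in t∉A (t∈all A∈)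

gaps≤-of-extreme : ∀ m {s₂ s₃} N → All (_≤ 3 + m) N → s₂ ≤ 2 + m → s₃ ≤ 2 + m →
  (3 ≤ 2 + length N → suc (length N) * (3 + m) < s₂ + (s₃ + sum N)) → sum (map (3 + m ∸_) N) ≤ m
gaps≤-of-extreme m []           _   _   _   _       = z≤n
gaps≤-of-extreme m {s₂} {s₃} N@(_ ∷ _) N≤n s₂≤ s₃≤ extreme = +-cancelʳ-≤ (S + (4 + m)) G m (begin
  G + (S + (4 + m))              ≡⟨ shift G S m ⟩
  suc (3 + m + (G + S))          ≡⟨ cong (λ k → suc (3 + m + k)) (sum-∸+sum N N≤n) ⟩
  suc (suc (length N) * (3 + m)) ≤⟨ extreme (s≤s (s≤s (s≤s z≤n))) ⟩
  s₂ + (s₃ + S)                  ≤⟨ +-mono-≤ s₂≤ (+-monoˡ-≤ S s₃≤) ⟩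
  (2 + m) + ((2 + m) + S)        ≡⟨ unshift S m ⟩
  m + (S + (4 + m)) ∎)
  where
  open ≤-Reasoning
  G = sum (map (3 + m ∸_) N)
  S = sum N
  shift : ∀ G S m → G + (S + (4 + m)) ≡ suc (3 + m + (G + S))
  shift = solve-∀
  unshift : ∀ S m → (2 + m) + ((2 + m) + S) ≡ m + (S + (4 + m))
  unshift = solve-∀

m≤gaps-of-admissible : ∀ m {s₁ s₂ s₃} N → All (_≤ 3 + m) N → s₁ ≤ 2 + m → s₂ ≤ 2 + m → s₃ ≤ 2 + m →
  s₁ + (s₂ + (s₃ + sum N)) ≤ suc (suc (length N)) * (3 + m) →
  m ≤ (2 + m ∸ s₁) + ((2 + m ∸ s₂) + ((2 + m ∸ s₃) + sum (map (3 + m ∸_) N)))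
m≤gaps-of-admissible m {s₁} {s₂} {s₃} N N≤n s₁≤ s₂≤ s₃≤ admissible = +-cancelʳ-≤ Σs m Σg (begin
  m + Σs                                             ≤⟨ +-monoʳ-≤ m admissible ⟩
  m + suc (suc (length N)) * (3 + m)                 ≡⟨ regroup m (length N) ⟩
  (2 + m) + ((2 + m) + ((2 + m) + length N * (3 + m))) ≡⟨ cong₂ _+_ (sym (m∸n+n≡m s₁≤)) (cong₂ _+_ (sym (m∸n+n≡m s₂≤))
                                                            (cong₂ _+_ (sym (m∸n+n≡m s₃≤)) (sym (sum-∸+sum N N≤n)))) ⟩
  (g₁ + s₁) + ((g₂ + s₂) + ((g₃ + s₃) + (G + S)))    ≡⟨ interleave g₁ s₁ g₂ s₂ g₃ s₃ G S ⟩
  Σg + Σs ∎)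
  where
  open ≤-Reasoning
  g₁ = 2 + m ∸ s₁
  g₂ = 2 + m ∸ s₂
  g₃ = 2 + m ∸ s₃
  G = sum (map (3 + m ∸_) N)
  S = sum N
  Σs = s₁ + (s₂ + (s₃ + S))
  Σg = g₁ + (g₂ + (g₃ + G))
  regroup : ∀ m l → m + (2 + l) * (3 + m) ≡ (2 + m) + ((2 + m) + ((2 + m) + l * (3 + m)))
  regroup = solve-∀
  interleave : ∀ a b c d e f g h → (a + b) + ((c + d) + ((e + f) + (g + h))) ≡ (a + (c + (e + g))) + (b + (d + (f + h)))
  interleave = solve-∀

extreme⇒InΛ : ∀ m {v : Vec ℕ (4 + m)} {zs} → Extreme (InP (3 + m)) v → Counts v zs → Admissible (3 + m) zs → InΛ (3 + m) v
extreme⇒InΛ m {zs = []}         _ _ (_ , ()            , _)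
extreme⇒InΛ m {zs = _ ∷ []}     _ _ (_ , s≤s ()        , _)
extreme⇒InΛ m {zs = _ ∷ _ ∷ []} _ _ (_ , s≤s (s≤s ()) , _)
extreme⇒InΛ m {zs = s₁ ∷ s₂ ∷ s₃ ∷ N} v-extreme v≈zs admissible@(zs⊆R@(s₁∈R ∷ s₂∈R ∷ s₃∈R ∷ N⊆R) , _ , sum≤) =
  let unique , intersecting , non-trivial , sizes≡ = family-realises m {s₁} {s₂} {s₃} {N} zs⊆R disjoint cover
  in  F , unique , intersecting , non-trivial
    , counts-unique {zs = s₁ ∷ s₂ ∷ s₃ ∷ N} (subst (Counts (profile F)) sizes≡ (profile-counts F)) v≈zs
  where
  F = build m (familySpec m s₁ s₂ s₃ N)
  ≤n : ∀ {s} → ProperSize (3 + m) s → s ≤ 2 + m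
  ≤n = proj₂ ∘ ∈-range⁻ {2} {2 + m}
  N≤n = All.map (m≤n⇒m≤1+n ∘ ≤n) N⊆R
  disjoint : sum (map (3 + m ∸_) N) ≤ m
  disjoint = gaps≤-of-extreme m N N≤n (≤n s₂∈R) (≤n s₃∈R) (extreme-sum> v-extreme v≈zs admissible)
  cover : m ≤ totalGap m (familySpec m s₁ s₂ s₃ N)
  cover = subst (m ≤_) (cong (λ G → (2 + m ∸ s₁) + ((2 + m ∸ s₂) + ((2 + m ∸ s₃) + G))) (cong sum (map-∘ N)))
                (m≤gaps-of-admissible m N N≤n (≤n s₁∈R) (≤n s₂∈R) (≤n s₃∈R) sum≤)

lemma2p6 : (n : ℕ) (e : Vec ℕ (suc n)) → InΓe n e → Extreme (InΛ n) e
-- For n ≤ 2 the index range [2, n − 1] is empty, so x = 0.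
lemma2p6 zero             e ((_ , _ , _ , () , _) , _)
lemma2p6 (suc zero)       e ((_ , _ , _ , () , _) , _)
lemma2p6 (suc (suc zero)) e ((_ , _ , _ , () , _) , _)
lemma2p6 (suc (suc (suc m))) e e-extreme@(e∈P@(_ , _ , eₙ≡0 , _) , not-comb) =
    extreme⇒InΛ m {zs = expand (at e) (range 2 (2 + m))} e-extreme (InP-counts {e = e} e∈P) (InP⇒Admissible {e = e} e∈P)
  , not-comb ∘ convexComb-face (fromℕ _) last≡0 InΛ∧last≡0⇒InP
  where
  last≡0 : lookup e (fromℕ (3 + m)) ≡ 0
  last≡0 = trans (sym (at-toℕ e (fromℕ _))) (trans (cong (at e) (toℕ-fromℕ (3 + m))) eₙ≡0)
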